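{- Let $p$ be a prime, $k\ge1$, and let $G=(V,E)$ be a connected graph with vertices ordered $v_1,\dots,v_n$ and edge-labeling $\alpha:E\to\{\text{ideals of }\mathbb{Z}/p^k\mathbb{Z}\}$. Let $\mathbb{B}_{p^k}$ be the minimum generating set described in the context. Then for any two distinct splines in $\mathbb{B}_{p^k}$, their supports are either disjoint or one is a proper subset of the other. Moreover, if $\mathbf{b}^{(i)},\mathbf{b}^{(j)}\in\mathbb{B}_{p^k}$ have non-disjoint supports, $\mathbf{b}^{(i)}$ has nonzero entries $p^s$ and $\mathbf{b}^{(j)}$ has nonzero entries $p^r$ with $s<r$, then the support of $\mathbf{b}^{(j)}$ is a proper subset of the support of $\mathbf{b}^{(i)}$.
   Context: For a commutative ring $R$, a finite connected graph $G$ and an edge-labeling $\alpha$ assigning to each edge an ideal of $R$, a spline is $\mathbf{f}\in R^{|V|}$ with $\mathbf{f}_u-\mathbf{f}_v\in\alpha(uv)$ for every edge $uv$. The support of a spline is the set of vertices where it is nonzero. For $1\le\gamma\le k$, $\alpha_\gamma$ is the reduction of $\alpha$ via $\mathbb{Z}/p^k\mathbb{Z}\to\mathbb{Z}/p^\gamma\mathbb{Z}$; a zero-connected component of $(G,\alpha_\gamma)$ is a class of vertices joined by paths of edges whose label is the zero ideal; $V^{(i,\gamma)}$ is the zero-connected component of $(G,\alpha_\gamma)$ with smallest-index vertex $v_i$, and $I_\gamma$ is the set of such indices ($I_0=\emptyset$). $\mathbb{B}_{p^k}$ consists of, for each $1\le\gamma\le k$ and each $i\in I_\gamma\setminus I_{\gamma-1}$,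 the spline over $\mathbb{Z}/p^k\mathbb{Z}$ with value $p^{\gamma-1}$ on $V^{(i,\gamma)}$ and $0$ elsewhere. -}

module Defs where

open import Data.Nat using (ℕ; zero; suc; _^_; _∸_; _≤_)
open import Data.Nat.Divisibility using (_∣_)
open import Data.Fin using (Fin) renaming (_≤_ to _≤ᶠ_)
open import Data.List using (List)
open import Data.List.Membership.Propositional using (_∈_)
open import Data.Product using (_×_; _,_; ∃)
open import Data.Sum using (_⊎_)
open import Data.Empty using (⊥)
open import Data.Unit using (⊤)
open import Relation.Nullary using (¬_)
open import Relation.Binary.PropositionalEquality using (_≡_)

-- Every ideal of ℤ/p^kℤ is principal;
-- an entry (u , v , a) is an edge uv labeled by the ideal ⟨a mod p^k⟩.
record LabeledGraph (n : ℕ) : Set where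
  field
    edges : List (Fin n × Fin n × ℕ)
open LabeledGraph public

EdgeIn : ∀ {n} → LabeledGraph n → Fin n → Fin n → ℕ → Set
EdgeIn G u v a = ((u , v , a) ∈ edges G) ⊎ ((v , u , a) ∈ edges G)

data Path {n : ℕ} (G : LabeledGraph n) (P : ℕ → Set) : Fin n → Fin n → Set where
  here : ∀ {u} → Path G P u u
  step : ∀ {u w v a} → EdgeIn G u w a → P a → Path G P w v → Path G P u v

Connected : ∀ {n} → LabeledGraph n → Set
Connected G = ∀ u v → Path G (λ _ → ⊤) u v

-- u and v lie in the same zero-connected component of (G, α_γ):
-- the reduction of ⟨a⟩ to ℤ/p^γℤ is the zero ideal iff p^γ ∣ a.
ZeroConn : ∀ {n} → ℕ → LabeledGraph n → ℕ → Fin n → Fin n → Set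
ZeroConn p G γ u v = Path G (λ a → p ^ γ ∣ a) u v

-- i ∈ I_γ : v_i is the smallest-index vertex of its zero-connected
-- component of (G, α_γ).  I_0 = ∅.
InI : ∀ {n} → ℕ → LabeledGraph n → ℕ → Fin n → Set
InI p G zero    i = ⊥
InI p G (suc g) i = ∀ j → ZeroConn p G (suc g) i j → i ≤ᶠ j

-- (γ , i) indexes an element of 𝔹_{p^k}: 1 ≤ γ ≤ k, i ∈ I_γ ∖ I_{γ-1}
InB : ∀ {n} → ℕ → ℕ → LabeledGraph n → ℕ → Fin n → Set
InB p k G γ i = (1 ≤ γ) × (γ ≤ k) × InI p G γ i × ¬ InI p G (γ ∸ 1) i

-- b (entries given by representatives in ℕ) is the element of 𝔹_{p^k}
-- indexed by (γ , i): value p^(γ-1) on V^(i,γ), 0 elsewhere.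
IsBSpline : ∀ {n} → ℕ → LabeledGraph n → ℕ → Fin n → (Fin n → ℕ) → Set
IsBSpline p G γ i b =
  ∀ v → (ZeroConn p G γ i v → b v ≡ p ^ (γ ∸ 1))
      × (¬ ZeroConn p G γ i v → b v ≡ 0)

-- support of f ∈ (ℤ/p^kℤ)^n: vertices where the entry is nonzero mod p^k
Supp : ∀ {n} → ℕ → ℕ → (Fin n → ℕ) → Fin n → Set
Supp p k f v = ¬ (p ^ k ∣ f v)

Disjoint : ∀ {n} → (Fin n → Set) → (Fin n → Set) → Set
Disjoint S T = ∀ v → S v → T v → ⊥

ProperSubset : ∀ {n} → (Fin n → Set) → (Fin n → Set) → Set
ProperSubset S T = (∀ v → S v → T v) × ∃ λ v → T v × ¬ S v

module Submission where

-- The element b of 𝔹_{p^k} indexed by (γ , i) has support exactly the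
-- zero-connected component V^(i,γ), with constant value p^(γ-1) there, and
-- i is the smallest vertex of that component.  Raising γ makes fewer edge
-- labels vanish, so the components at level γ' ≥ γ refine those at level γ.
-- Hence, for γ ≤ γ':
--   * if the supports of b and b' meet, then j ∈ V^(i,γ)   (supports-meet);
--   * if moreover γ < γ', then V^(j,γ') ⊆ V^(i,γ), and the inclusion is
--     proper because i itself is missing from V^(j,γ'): otherwise i = j
--     would already lie in I_{γ'-1}, contradicting the choice of (γ' , j);
--   * if γ = γ' and the supports meet, then i = j and b = b'.
-- The value comparison s < r in the second claim forces γ < γ' because
-- n ↦ p^n is injective.

open import Defs
open import Data.Nat using (ℕ; zero; suc; _^_; _≤_; _<_; _∸_; _*_; z≤n; s≤s; NonZero)
open import Data.Nat.Properties
  using (≤-trans; ≤-antisym; <⇒≤; ≮⇒≥; <-irrefl; <⇒≱; ≤-total;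
         m≤n⇒m<n∨m≡n; ∸-monoˡ-≤; m+[n∸m]≡n; ^-distribˡ-+-*; ^-monoʳ-<; m^n≢0)
open import Data.Nat.Divisibility using (_∣_; _∣?_; ∣-trans; m∣m*n; ∣⇒≤; _∣0)
open import Data.Nat.Primality using (Prime; prime⇒nonTrivial)
open import Data.Nat.Base using (nonTrivial⇒n>1; >-nonZero)
open import Data.Fin using (Fin) renaming (_≤_ to _≤ᶠ_)
import Data.Fin.Properties as Fin
open import Data.List using (List; []; _∷_)
open import Data.List.Relation.Unary.Any using (here; there)
open import Data.Product using (_×_; ∃; _,_; proj₁; proj₂)
open import Data.Sum using (_⊎_; inj₁; inj₂)
open import Function using (_∘_)
open import Relation.Nullary using (¬_; Dec; yes; no; contradiction)
open import Relation.Nullary.Decidable using (map′; _×-dec_; _⊎-dec_)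
open import Relation.Binary.PropositionalEquality
  using (_≡_; refl; sym; trans; cong; subst; subst₂)

module _ {n : ℕ} {G : LabeledGraph n} {P : ℕ → Set} where

  _▹_ : ∀ {u v w} → Path G P u v → Path G P v w → Path G P u w
  here        ▹ q = q
  step e a r  ▹ q = step e a (r ▹ q)

  flip-edge : ∀ {u v a} → EdgeIn G u v a → EdgeIn G v u a
  flip-edge (inj₁ e) = inj₂ e
  flip-edge (inj₂ e) = inj₁ e

  reverse : ∀ {u v} → Path G P u v → Path G P v u
  reverse here         = here
  reverse (step e a r) = reverse r ▹ step (flip-edge e) a here

  weaken : ∀ {Q : ℕ → Set} → (∀ {a} → P a → Q a) → ∀ {u v} → Path G P u v → Path G Q u v
  weaken f here         = here
  weaken f (step e a r) = step e (f a) (weaken f r)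

-- Adding an edge xy with label in P creates exactly the new paths that run
-- through xy once, so decidability follows by induction on the edge list.
module Reachability {n : ℕ} (P : ℕ → Set) (P? : ∀ a → Dec (P a)) where

  Edges : Set
  Edges = List (Fin n × Fin n × ℕ)

  graph : Edges → LabeledGraph n
  graph L = record { edges = L }

  Reach : Edges → Fin n → Fin n → Set
  Reach L = Path (graph L) P

  reach-[] : ∀ {u v} → Reach [] u v → u ≡ v
  reach-[] here                   = refl
  reach-[] (step (inj₁ ()) _ _)
  reach-[] (step (inj₂ ()) _ _)

  extend : ∀ {e L u v} → Reach L u v → Reach (e ∷ L) u v
  extend here                    = here
  extend (step (inj₁ m) a r)     = step (inj₁ (there m)) a (extend r)
  extend (step (inj₂ m) a r)     = step (inj₂ (there m)) a (extend r)

  avoid : ∀ {x y a L} → ¬ P a → ∀ {u v} → Reach ((x , y , a) ∷ L) u v → Reach L u v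
  avoid ¬a here                             = here
  avoid ¬a (step (inj₁ (here refl)) a _)    = contradiction a ¬a
  avoid ¬a (step (inj₂ (here refl)) a _)    = contradiction a ¬a
  avoid ¬a (step (inj₁ (there m)) a r)      = step (inj₁ m) a (avoid ¬a r)
  avoid ¬a (step (inj₂ (there m)) a r)      = step (inj₂ m) a (avoid ¬a r)

  Via : Edges → Fin n → Fin n → Fin n → Fin n → Set
  Via L x y u v = Reach L u v ⊎ (Reach L u x × Reach L y v) ⊎ (Reach L u y × Reach L x v)

  via-cons : ∀ {L x y u w v} → Reach L u w → Via L x y w v → Via L x y u v
  via-cons q (inj₁ r)              = inj₁ (q ▹ r)
  via-cons q (inj₂ (inj₁ (r , s))) = inj₂ (inj₁ (q ▹ r , s))
  via-cons q (inj₂ (inj₂ (r , s))) = inj₂ (inj₂ (q ▹ r , s))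

  split : ∀ {x y a L} → P a → ∀ {u v} → Reach ((x , y , a) ∷ L) u v → Via L x y u v
  split pa here = inj₁ here
  split pa (step (inj₁ (here refl)) _ r) with split pa r
  ... | inj₁ q              = inj₂ (inj₁ (here , q))
  ... | inj₂ (inj₁ (_ , q)) = inj₂ (inj₁ (here , q))
  ... | inj₂ (inj₂ (_ , q)) = inj₁ q
  split pa (step (inj₂ (here refl)) _ r) with split pa r
  ... | inj₁ q              = inj₂ (inj₂ (here , q))
  ... | inj₂ (inj₁ (_ , q)) = inj₁ q
  ... | inj₂ (inj₂ (_ , q)) = inj₂ (inj₂ (here , q))
  split pa (step (inj₁ (there m)) b r) = via-cons (step (inj₁ m) b here) (split pa r)
  split pa (step (inj₂ (there m)) b r) = via-cons (step (inj₂ m) b here) (split pa r)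

  join : ∀ {x y a L} → P a → ∀ {u v} → Via L x y u v → Reach ((x , y , a) ∷ L) u v
  join pa (inj₁ q)              = extend q
  join pa (inj₂ (inj₁ (q , r))) = extend q ▹ (step (inj₁ (here refl)) pa here ▹ extend r)
  join pa (inj₂ (inj₂ (q , r))) = extend q ▹ (step (inj₂ (here refl)) pa here ▹ extend r)

  reach? : ∀ L u v → Dec (Reach L u v)
  reach? [] u v = map′ (λ { refl → here }) reach-[] (u Fin.≟ v)
  reach? ((x , y , a) ∷ L) u v with P? a
  ... | no ¬a = map′ extend (avoid ¬a) (reach? L u v)
  ... | yes a = map′ (join a) (split a)
    (reach? L u v ⊎-dec (reach? L u x ×-dec reach? L y v) ⊎-dec (reach? L u y ×-dec reach? L x v))

module Powers (p : ℕ) (1<p : 1 < p) where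

  instance
    p≢0 : NonZero p
    p≢0 = >-nonZero (≤-trans (s≤s z≤n) 1<p)

  pow-∣-pow : ∀ {a b} → a ≤ b → p ^ a ∣ p ^ b
  pow-∣-pow {a} {b} a≤b = subst (p ^ a ∣_) split-power (m∣m*n (p ^ (b ∸ a)))
    where
    split-power : p ^ a * p ^ (b ∸ a) ≡ p ^ b
    split-power = trans (sym (^-distribˡ-+-* p a (b ∸ a))) (cong (p ^_) (m+[n∸m]≡n a≤b))

  pow-∤-pow : ∀ {m k} → m < k → ¬ (p ^ k ∣ p ^ m)
  pow-∤-pow {m} m<k d = <⇒≱ (^-monoʳ-< p 1<p m<k) (∣⇒≤ {{m^n≢0 p m}} d)

  pow-injective : ∀ {a b} → p ^ a ≡ p ^ b → a ≡ b
  pow-injective eq = ≤-antisym (≮⇒≥ (λ b<a → <-irrefl (sym eq) (^-monoʳ-< p 1<p b<a)))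
                               (≮⇒≥ (λ a<b → <-irrefl eq (^-monoʳ-< p 1<p a<b)))

pred-reflects-< : ∀ {a c} → a ∸ 1 < c ∸ 1 → a < c
pred-reflects-< {zero}  {suc c} _  = s≤s z≤n
pred-reflects-< {suc a} {suc c} lt = s≤s lt

module _ {n : ℕ} where

  Disjoint-sym : {S T : Fin n → Set} → Disjoint S T → Disjoint T S
  Disjoint-sym d v t s = d v s t

module ZeroComponents (p : ℕ) (1<p : 1 < p) {n : ℕ} (G : LabeledGraph n) where
  open Powers p 1<p

  Z : ℕ → Fin n → Fin n → Set
  Z γ = ZeroConn p G γ

  Z? : ∀ γ u v → Dec (Z γ u v)
  Z? γ = Reachability.reach? (λ a → p ^ γ ∣ a) (λ a → p ^ γ ∣? a) (edges G)

  Z-antitone : ∀ {γ γ'} → γ ≤ γ' → ∀ {u v} → Z γ' u v → Z γ u v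
  Z-antitone γ≤γ' = weaken (∣-trans (pow-∣-pow γ≤γ'))

  I-min : ∀ γ {i w} → InI p G γ i → Z γ i w → i ≤ᶠ w
  I-min (suc γ) i∈I z = i∈I _ z

  I-unique : ∀ γ {i j} → InI p G γ i → InI p G γ j → Z γ i j → i ≡ j
  I-unique γ i∈I j∈I z = Fin.≤-antisym (I-min γ i∈I z) (I-min γ j∈I (reverse z))

  I-ascends : ∀ {γ γ' i} → γ ≤ γ' → InI p G γ i → InI p G γ' i
  I-ascends {suc γ} {suc γ'} γ≤γ' i∈I w z = i∈I w (Z-antitone γ≤γ' z)

module BSpline (p : ℕ) (1<p : 1 < p) (k : ℕ) {n : ℕ} (G : LabeledGraph n) where
  open Powers p 1<p
  open ZeroComponents p 1<p G

  module Shape {γ i b} (B : InB p k G γ i) (S : IsBSpline p G γ i b) where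

    level<k : γ ∸ 1 < k
    level<k = below (proj₁ B) (proj₁ (proj₂ B))
      where
      below : ∀ {g k} → 1 ≤ g → g ≤ k → g ∸ 1 < k
      below (s≤s z≤n) g≤k = g≤k

    supp⇒Z : ∀ {v} → Supp p k b v → Z γ i v
    supp⇒Z {v} s with Z? γ i v
    ... | yes z = z
    ... | no ¬z = contradiction (subst (p ^ k ∣_) (sym (proj₂ (S v) ¬z)) ((p ^ k) ∣0)) s

    Z⇒supp : ∀ {v} → Z γ i v → Supp p k b v
    Z⇒supp {v} z d = pow-∤-pow level<k (subst (p ^ k ∣_) (proj₁ (S v) z) d)

    value : ∀ {v} → Supp p k b v → b v ≡ p ^ (γ ∸ 1)
    value {v} s = proj₁ (S v) (supp⇒Z s)

    index∈I : InI p G γ i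
    index∈I = proj₁ (proj₂ (proj₂ B))

    index∉I : ¬ InI p G (γ ∸ 1) i
    index∉I = proj₂ (proj₂ (proj₂ B))

  determined : ∀ {γ i b b'} → IsBSpline p G γ i b → IsBSpline p G γ i b' → ∀ v → b v ≡ b' v
  determined {γ} {i} S S' v with Z? γ i v
  ... | yes z = trans (proj₁ (S v) z) (sym (proj₁ (S' v) z))
  ... | no ¬z = trans (proj₂ (S v) ¬z) (sym (proj₂ (S' v) ¬z))

  module Pair {γ γ' i j b b'}
              (B : InB p k G γ i) (S : IsBSpline p G γ i b)
              (B' : InB p k G γ' j) (S' : IsBSpline p G γ' j b')
              (γ≤γ' : γ ≤ γ') where
    private
      module b  = Shape B S
      module b' = Shape B' S'

    supports-meet : ∀ {v} → Supp p k b v → Supp p k b' v → Z γ i j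
    supports-meet s s' = b.supp⇒Z s ▹ reverse (Z-antitone γ≤γ' (b'.supp⇒Z s'))

    -- V^(j,γ') ⊊ V^(i,γ) once j ∈ V^(i,γ) and γ < γ'; the vertex i is the
    -- witness, since i ∈ V^(j,γ') would force i = j ∈ I_{γ'-1}
    nested : γ < γ' → Z γ i j → ProperSubset (Supp p k b') (Supp p k b)
    nested γ<γ' zij = (λ v s' → b.Z⇒supp (zij ▹ Z-antitone γ≤γ' (b'.supp⇒Z s')))
                    , i , b.Z⇒supp here , i∉supp'
      where
      γ≤γ'-1 : γ ≤ γ' ∸ 1
      γ≤γ'-1 = ∸-monoˡ-≤ 1 γ<γ'
      i∉supp' : ¬ Supp p k b' i
      i∉supp' s' = b'.index∉I (subst (InI p G (γ' ∸ 1)) i≡j (I-ascends γ≤γ'-1 b.index∈I))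
        where
        i≡j : i ≡ j
        i≡j = Fin.≤-antisym (I-min γ b.index∈I zij) (I-min γ' b'.index∈I (b'.supp⇒Z s'))

    laminar : ¬ (∀ v → b v ≡ b' v) →
              Disjoint (Supp p k b) (Supp p k b') ⊎ ProperSubset (Supp p k b') (Supp p k b)
    laminar b≢b' with Z? γ i j | m≤n⇒m<n∨m≡n γ≤γ'
    ... | no ¬z | _          = inj₁ (λ v s s' → ¬z (supports-meet s s'))
    ... | yes z | inj₁ γ<γ'  = inj₂ (nested γ<γ' z)
    ... | yes z | inj₂ refl  = contradiction (determined {γ} S (subst (λ x → IsBSpline p G γ x b') (sym i≡j) S')) b≢b'
      where
      i≡j : i ≡ j
      i≡j = I-unique γ b.index∈I b'.index∈I z

lemma5p4 : (p : ℕ) → Prime p → (k : ℕ) → 1 ≤ k →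
    (n : ℕ) → (G : LabeledGraph n) → Connected G →
    (γ γ' : ℕ) (i j : Fin n) (b b' : Fin n → ℕ) →
    InB p k G γ i → InB p k G γ' j →
    IsBSpline p G γ i b → IsBSpline p G γ' j b' →
    ¬ (∀ v → b v ≡ b' v) →
    (Disjoint (Supp p k b) (Supp p k b')
      ⊎ ProperSubset (Supp p k b) (Supp p k b')
      ⊎ ProperSubset (Supp p k b') (Supp p k b))
    × ((s r : ℕ) →
       (∀ v → Supp p k b v → b v ≡ p ^ s) →
       (∀ v → Supp p k b' v → b' v ≡ p ^ r) →
       s < r →
       (∃ λ v → Supp p k b v × Supp p k b' v) →
       ProperSubset (Supp p k b') (Supp p k b))
lemma5p4 p p-prime k _ n G _ γ γ' i j b b' B B' S S' b≢b' = comparable , value-order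
  where
  1<p : 1 < p
  1<p = nonTrivial⇒n>1 p {{prime⇒nonTrivial p-prime}}
  open Powers p 1<p
  open BSpline p 1<p k G

  comparable : Disjoint (Supp p k b) (Supp p k b')
             ⊎ ProperSubset (Supp p k b) (Supp p k b')
             ⊎ ProperSubset (Supp p k b') (Supp p k b)
  comparable with ≤-total γ γ'
  ... | inj₁ γ≤γ' with Pair.laminar B S B' S' γ≤γ' b≢b'
  ...   | inj₁ disjoint = inj₁ disjoint
  ...   | inj₂ b'⊊b     = inj₂ (inj₂ b'⊊b)
  comparable | inj₂ γ'≤γ with Pair.laminar B' S' B S γ'≤γ (b≢b' ∘ λ eq v → sym (eq v))
  ...   | inj₁ disjoint = inj₁ (Disjoint-sym disjoint)
  ...   | inj₂ b⊊b'     = inj₂ (inj₁ b⊊b')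

  value-order : (s r : ℕ) →
    (∀ v → Supp p k b v → b v ≡ p ^ s) →
    (∀ v → Supp p k b' v → b' v ≡ p ^ r) →
    s < r →
    (∃ λ v → Supp p k b v × Supp p k b' v) →
    ProperSubset (Supp p k b') (Supp p k b)
  value-order s r bs b'r s<r (v , sv , sv') = Pair.nested B S B' S' (<⇒≤ γ<γ') γ<γ'
                                                (Pair.supports-meet B S B' S' (<⇒≤ γ<γ') sv sv')
    where
    s≡ : s ≡ γ ∸ 1
    s≡ = pow-injective (trans (sym (bs v sv)) (Shape.value B S sv))
    r≡ : r ≡ γ' ∸ 1
    r≡ = pow-injective (trans (sym (b'r v sv')) (Shape.value B' S' sv'))
    γ<γ' : γ < γ'
    γ<γ' = pred-reflects-< (subst₂ _<_ s≡ r≡ s<r)
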